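{- Let $n,x\in\mathbb{N}$ with $x\le n$. Then the smallest nonnegative integer $k$ such that $F_n(x,k)>0$ is $\left\lfloor \frac{n}{n-x+1}\right\rfloor$.
   Context: For integers $n,x,k\ge 0$, $B_n^{x,k}$ denotes the set of binary strings of length $n$ that contain exactly $x$ zeros and in which the longest block of consecutive zeros has length exactly $k$. $F_n(x,k)=|B_n^{x,k}|$. -}

module Defs where

open import Data.Bool using (Bool; true; false; if_then_else_)
open import Data.Nat using (ℕ; zero; suc; _+_; _⊔_)
open import Data.Vec using (Vec; []; _∷_)
open import Data.List using (List; []; _∷_; map; _++_; length; filter)
open import Relation.Nullary.Decidable using (_×-dec_)
open import Relation.Binary.PropositionalEquality using (_≡_)
open import Data.Nat.Properties using (_≟_)

-- Binary strings of length n: Vec Bool n, with false = the digit 0, true = the digit 1.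

allStrings : (n : ℕ) → List (Vec Bool n)
allStrings zero = [] ∷ []
allStrings (suc n) = map (false ∷_) (allStrings n) ++ map (true ∷_) (allStrings n)

zeros : ∀ {n} → Vec Bool n → ℕ
zeros [] = 0
zeros (false ∷ s) = suc (zeros s)
zeros (true ∷ s) = zeros s

-- Longest block of consecutive zeros, scanning left to right with
-- cur = length of the current run of zeros, best = longest run seen so far.
longestRunAux : ∀ {n} → ℕ → ℕ → Vec Bool n → ℕ
longestRunAux cur best [] = best
longestRunAux cur best (false ∷ s) = longestRunAux (suc cur) (best ⊔ suc cur) s
longestRunAux cur best (true ∷ s) = longestRunAux 0 best s

longestZeroRun : ∀ {n} → Vec Bool n → ℕ
longestZeroRun = longestRunAux 0 0

F : ℕ → ℕ → ℕ → ℕ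
F n x k = length (filter (λ s → (zeros s ≟ x) ×-dec (longestZeroRun s ≟ k)) (allStrings n))

module Submission where

-- Write m = n ∸ x for the number of ones, so n = x + m, and let
-- q = ⌊(x + m) / (m + 1)⌋.  Arithmetically, q is the least k with
-- x ≤ (m + 1) * k (it is ⌈x / (m + 1)⌉), and moreover q ≤ x.
--
-- Lower bound: the m ones cut a string into at most m + 1 blocks of
-- zeros, so x ≤ (m + 1) * (longest block); no string is counted by
-- F n x k when (m + 1) * k < x, i.e. when k < q.
--
-- Attainment: whenever x ≤ (m + 1) * q, the string made of blocks of q
-- zeros separated by single ones (the last block possibly shorter, the
-- unused ones at the end) has x zeros and longest block x ⊓ q.

open import Defs
open import Data.Nat using (ℕ; suc; _≤_; _<_; _∸_; _/_)
open import Data.Product using (_×_)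
open import Relation.Binary.PropositionalEquality using (_≡_)

open import Data.Nat using (zero; _+_; _*_; _⊔_; _⊓_; z≤n; s≤s; _%_; _≤?_)
open import Data.Nat.Properties
open import Data.Nat.DivMod using (m/n*n≤m; m<n*o⇒m/o<n; m≡m%n+[m/n]*n; m%n<n)
open import Data.Bool using (Bool; true; false)
open import Data.Vec using (Vec; []; _∷_; replicate; _++_)
open import Data.List using (map; length)
open import Data.List.Relation.Unary.Any as Any using (here)
open import Data.List.Relation.Unary.All as All using ()
open import Data.List.Membership.Propositional using (_∈_)
open import Data.List.Membership.Propositional.Properties using (∈-++⁺ˡ; ∈-++⁺ʳ; ∈-map⁺)
open import Data.List.Properties using (filter-some; filter-none)
open import Data.Product using (Σ; _,_; proj₁; proj₂)
open import Data.Empty using (⊥-elim)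
open import Relation.Nullary using (¬_; yes; no)
open import Relation.Nullary.Decidable using (_×-dec_)
open import Relation.Binary.PropositionalEquality
  using (refl; sym; trans; cong; subst; subst₂; module ≡-Reasoning)

ones : ∀ {n} → Vec Bool n → ℕ
ones [] = 0
ones (false ∷ s) = ones s
ones (true ∷ s) = suc (ones s)

zeros+ones≡length : ∀ {n} (s : Vec Bool n) → zeros s + ones s ≡ n
zeros+ones≡length [] = refl
zeros+ones≡length (false ∷ s) = cong suc (zeros+ones≡length s)
zeros+ones≡length (true ∷ s) =
  trans (+-suc (zeros s) (ones s)) (cong suc (zeros+ones≡length s))

-- The "best so far" accumulator of the scan only enters through a final
-- maximum; this separates what a prefix contributes from the rest.
longestRunAux-best : ∀ {n} c b (s : Vec Bool n) →
  longestRunAux c b s ≡ b ⊔ longestRunAux c 0 s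
longestRunAux-best c b [] = sym (⊔-identityʳ b)
longestRunAux-best c b (false ∷ s) = begin
  longestRunAux (suc c) (b ⊔ suc c) s       ≡⟨ longestRunAux-best (suc c) (b ⊔ suc c) s ⟩
  b ⊔ suc c ⊔ longestRunAux (suc c) 0 s     ≡⟨ ⊔-assoc b (suc c) _ ⟩
  b ⊔ (suc c ⊔ longestRunAux (suc c) 0 s)   ≡⟨ cong (b ⊔_) (sym (longestRunAux-best (suc c) (suc c) s)) ⟩
  b ⊔ longestRunAux (suc c) (suc c) s       ∎
  where open ≡-Reasoning
longestRunAux-best c b (true ∷ s) = longestRunAux-best 0 b s

-- Scanning a string whose (current run, best) state is (c, b) with c ≤ b:
-- the c zeros already seen plus the zeros of s lie in at most
-- ones s + 1 blocks, each of length at most the final result.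
zeros-bound-scan : ∀ {n} c b (s : Vec Bool n) → c ≤ b →
  c + zeros s ≤ suc (ones s) * longestRunAux c b s
zeros-bound-scan c b [] c≤b = subst (_≤ b + 0) (sym (+-identityʳ c)) (m≤n⇒m≤n+o 0 c≤b)
zeros-bound-scan c b (false ∷ s) c≤b =
  subst (_≤ suc (ones s) * longestRunAux (suc c) (b ⊔ suc c) s) (sym (+-suc c (zeros s)))
    (zeros-bound-scan (suc c) (b ⊔ suc c) s (m≤n⊔m b (suc c)))
zeros-bound-scan c b (true ∷ s) c≤b =
  +-mono-≤ (≤-trans c≤b b≤result) (zeros-bound-scan 0 b s z≤n)
  where
  b≤result : b ≤ longestRunAux 0 b s
  b≤result = subst (b ≤_) (sym (longestRunAux-best 0 b s)) (m≤m⊔n b _)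

zeros-bound : ∀ {n} (s : Vec Bool n) → zeros s ≤ suc (ones s) * longestZeroRun s
zeros-bound s = zeros-bound-scan 0 0 s z≤n

longestZeroRun-lower : ∀ x m (s : Vec Bool (x + m)) → zeros s ≡ x →
  x ≤ suc m * longestZeroRun s
longestZeroRun-lower x m s zeros≡x =
  subst₂ (λ z o → z ≤ suc o * longestZeroRun s) zeros≡x ones≡m (zeros-bound s)
  where
  ones≡m : ones s ≡ m
  ones≡m = +-cancelˡ-≡ x (ones s) m (subst (λ z → z + ones s ≡ x + m) zeros≡x (zeros+ones≡length s))

longestRunAux-zeros : ∀ {k} c b r (u : Vec Bool k) → c ≤ b →
  longestRunAux c b (replicate r false ++ u) ≡ longestRunAux (c + r) (b ⊔ (c + r)) u
longestRunAux-zeros c b zero u c≤b rewrite +-identityʳ c | m≥n⇒m⊔n≡m c≤b = refl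
longestRunAux-zeros c b (suc r) u c≤b
  rewrite +-suc c r | longestRunAux-zeros (suc c) (b ⊔ suc c) r u (m≤n⊔m b (suc c))
        | ⊔-assoc b (suc c) (suc c + r) | m≤n⇒m⊔n≡n (m≤m+n (suc c) r) = refl

longestRunAux-ones : ∀ m c b → longestRunAux c b (replicate m true) ≡ b
longestRunAux-ones zero c b = refl
longestRunAux-ones (suc m) c b = longestRunAux-ones m 0 b

zeros-++ : ∀ {k} r (u : Vec Bool k) → zeros (replicate r false ++ u) ≡ r + zeros u
zeros-++ zero u = refl
zeros-++ (suc r) u = cong suc (zeros-++ r u)

zeros-ones : ∀ m → zeros (replicate m true) ≡ 0
zeros-ones zero = refl
zeros-ones (suc m) = zeros-ones m

subst-invariant : ∀ {A : Set} (f : ∀ {n} → Vec Bool n → A) {a b} (eq : a ≡ b) (s : Vec Bool a) →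
  f (subst (Vec Bool) eq s) ≡ f s
subst-invariant f refl s = refl

balancedString : ∀ m x q → x ≤ suc m * q →
  Σ (Vec Bool (x + m)) (λ s → zeros s ≡ x × longestZeroRun s ≡ x ⊓ q)
balancedString m x q x≤cap with x ≤? q
... | yes x≤q = replicate x false ++ replicate m true , zeros≡x , longest≡x
  where
  zeros≡x : zeros (replicate x false ++ replicate m true) ≡ x
  zeros≡x = trans (zeros-++ x _) (trans (cong (x +_) (zeros-ones m)) (+-identityʳ x))
  longest≡x : longestZeroRun (replicate x false ++ replicate m true) ≡ x ⊓ q
  longest≡x = trans (longestRunAux-zeros 0 0 x _ z≤n)
                (trans (longestRunAux-ones m x x) (sym (m≤n⇒m⊓n≡m x≤q)))
balancedString zero x q x≤cap | no x≰q = ⊥-elim (x≰q (subst (x ≤_) (+-identityʳ q) x≤cap))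
balancedString (suc m) x q x≤cap | no x≰q =
  subst (Vec Bool) length≡ s , zeros≡x , longest≡q
  where
  q≤x : q ≤ x
  q≤x = ≰⇒≥ x≰q
  rest≤cap : x ∸ q ≤ suc m * q
  rest≤cap = subst (x ∸ q ≤_) (m+n∸m≡n q (suc m * q)) (∸-monoˡ-≤ q x≤cap)
  rec = balancedString m (x ∸ q) q rest≤cap
  r = proj₁ rec
  s : Vec Bool (q + suc (x ∸ q + m))
  s = replicate q false ++ (true ∷ r)
  length≡ : q + suc (x ∸ q + m) ≡ x + suc m
  length≡ = begin
    q + suc (x ∸ q + m)   ≡⟨ +-suc q _ ⟩
    suc (q + (x ∸ q + m)) ≡⟨ cong suc (sym (+-assoc q (x ∸ q) m)) ⟩
    suc (q + (x ∸ q) + m) ≡⟨ cong (λ z → suc (z + m)) (m+[n∸m]≡n q≤x) ⟩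
    suc (x + m)           ≡⟨ sym (+-suc x m) ⟩
    x + suc m             ∎
    where open ≡-Reasoning
  zeros≡x : zeros (subst (Vec Bool) length≡ s) ≡ x
  zeros≡x = begin
    zeros (subst (Vec Bool) length≡ s) ≡⟨ subst-invariant zeros length≡ s ⟩
    zeros s                            ≡⟨ zeros-++ q (true ∷ r) ⟩
    q + zeros r                        ≡⟨ cong (q +_) (proj₁ (proj₂ rec)) ⟩
    q + (x ∸ q)                        ≡⟨ m+[n∸m]≡n q≤x ⟩
    x                                  ∎
    where open ≡-Reasoning
  longest≡q : longestZeroRun (subst (Vec Bool) length≡ s) ≡ x ⊓ q
  longest≡q = begin
    longestZeroRun (subst (Vec Bool) length≡ s) ≡⟨ subst-invariant longestZeroRun length≡ s ⟩
    longestZeroRun s             ≡⟨ longestRunAux-zeros 0 0 q (true ∷ r) z≤n ⟩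
    longestRunAux 0 q r          ≡⟨ longestRunAux-best 0 q r ⟩
    q ⊔ longestZeroRun r         ≡⟨ cong (q ⊔_) (proj₂ (proj₂ rec)) ⟩
    q ⊔ ((x ∸ q) ⊓ q)            ≡⟨ m≥n⇒m⊔n≡m (m⊓n≤n (x ∸ q) q) ⟩
    q                            ≡⟨ sym (m≥n⇒m⊓n≡n q≤x) ⟩
    x ⊓ q                        ∎
    where open ≡-Reasoning

∈-allStrings : ∀ {n} (s : Vec Bool n) → s ∈ allStrings n
∈-allStrings [] = here refl
∈-allStrings {suc n} (false ∷ s) = ∈-++⁺ˡ (∈-map⁺ (false ∷_) (∈-allStrings s))
∈-allStrings {suc n} (true ∷ s) =
  ∈-++⁺ʳ (map (false ∷_) (allStrings n)) (∈-map⁺ (true ∷_) (∈-allStrings s))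

F-positive : ∀ {n x k} (s : Vec Bool n) → zeros s ≡ x → longestZeroRun s ≡ k → 0 < F n x k
F-positive {n} {x} {k} s zeros≡x longest≡k =
  filter-some (λ t → (zeros t ≟ x) ×-dec (longestZeroRun t ≟ k))
    (Any.map (λ { refl → zeros≡x , longest≡k }) (∈-allStrings s))

F-zero : ∀ {n x k} → (∀ (s : Vec Bool n) → zeros s ≡ x → ¬ longestZeroRun s ≡ k) → F n x k ≡ 0
F-zero {n} {x} {k} none =
  cong length (filter-none (λ t → (zeros t ≟ x) ×-dec (longestZeroRun t ≟ k))
    (All.tabulate {xs = allStrings n} (λ {s} _ (zeros≡x , longest≡k) → none s zeros≡x longest≡k)))

quotient≤ : ∀ x m → (x + m) / suc m ≤ x
quotient≤ x m = ≤-pred (m<n*o⇒m/o<n (s≤s x+m≤[1+x][1+m]))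
  where
  x+m≤[1+x][1+m] : x + m ≤ m + x * suc m
  x+m≤[1+x][1+m] = subst (_≤ m + x * suc m) (+-comm m x) (+-monoʳ-≤ m (m≤m*n x (suc m)))

quotient-covers : ∀ x m → x ≤ suc m * ((x + m) / suc m)
quotient-covers x m = +-cancelʳ-≤ m x (suc m * q) (begin
  x + m                      ≡⟨ m≡m%n+[m/n]*n (x + m) (suc m) ⟩
  (x + m) % suc m + q * suc m ≤⟨ +-monoˡ-≤ (q * suc m) (≤-pred (m%n<n (x + m) (suc m))) ⟩
  m + q * suc m              ≡⟨ cong (m +_) (*-comm q (suc m)) ⟩
  m + suc m * q              ≡⟨ +-comm m (suc m * q) ⟩
  suc m * q + m              ∎)
  where
  q = (x + m) / suc m
  open ≤-Reasoning

below-quotient : ∀ x m k → k < (x + m) / suc m → suc m * k < x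
below-quotient x m k k<q = +-cancelʳ-≤ m (suc (suc m * k)) x (begin
  suc (suc m * k) + m ≡⟨ +-comm (suc (suc m * k)) m ⟩
  m + suc (suc m * k) ≡⟨ +-suc m (suc m * k) ⟩
  suc m + suc m * k   ≡⟨ sym (*-suc (suc m) k) ⟩
  suc m * suc k       ≡⟨ *-comm (suc m) (suc k) ⟩
  suc k * suc m       ≤⟨ *-monoˡ-≤ (suc m) k<q ⟩
  q * suc m           ≤⟨ m/n*n≤m (x + m) (suc m) ⟩
  x + m               ∎)
  where
  q = (x + m) / suc m
  open ≤-Reasoning

least-longest-run : ∀ x m → let q = (x + m) / suc m in
  (0 < F (x + m) x q) × ((k : ℕ) → k < q → F (x + m) x k ≡ 0)
least-longest-run x m = attained , not-below
  where
  q = (x + m) / suc m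
  witness = balancedString m x q (quotient-covers x m)
  attained : 0 < F (x + m) x q
  attained = F-positive (proj₁ witness) (proj₁ (proj₂ witness))
    (trans (proj₂ (proj₂ witness)) (m≥n⇒m⊓n≡n (quotient≤ x m)))
  not-below : (k : ℕ) → k < q → F (x + m) x k ≡ 0
  not-below k k<q = F-zero λ s zeros≡x longest≡k →
    <⇒≱ (below-quotient x m k k<q)
      (subst (λ l → x ≤ suc m * l) longest≡k (longestZeroRun-lower x m s zeros≡x))

corollary2p2 : (n x : ℕ) → x ≤ n →
    (0 < F n x (n / suc (n ∸ x))) × ((k : ℕ) → k < n / suc (n ∸ x) → F n x k ≡ 0)
corollary2p2 n x x≤n with n ∸ x | m+[n∸m]≡n x≤n
... | m | refl = least-longest-run x m
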